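{- Let $R$ be a Riesz space with strong unit, $\mu$ a valuation on $\mathrm{Spec}(R)$ and $f\in R$ with $f\ge0$. Let $r<r'<s'<s$ be rationals, $I=(r',s')$, $J=(r,s)$, and let $p<q$ be rationals. Then $p<\Delta(J)$ or $\Delta[I]<q$.
   Context: A Riesz space is a $\mathbb{Q}$-vector space with a compatible lattice order; $1$ is a strong unit if every $x$ satisfies $-n1\le x\le n1$ for some $n$; rationals are identified with multiples of $1$. $\mathrm{Spec}(R)$ is the distributive lattice generated by symbols $D(a)$, $a\in R$, subject to $D(1)=1$, $D(a)\wedge D(-a)=0$, $D(a+b)\le D(a)\vee D(b)$, $D(a)=0$ if $a\le0$, $D(a\vee b)=D(a)\vee D(b)$. Lower reals are inhabited, downward closed, open subsets of $\mathbb{Q}$ ("$p<x$" means $p\in x$); upper reals dually ("$x<q$" means $q\in x$); $1-$(lower real) is an upper real. A valuation is a map $\mu$ from $\mathrm{Spec}(R)$ to nonnegative lower reals with $\mu(0)=0,\mu(1)=1$, $\mu(x)+\mu(y)=\mu(x\vee y)+\mu(x\wedge y)$, monotone, and $\mu(D(a))\le\sup_{\varepsilon>0}\mu(D(a-\varepsilon))$. Notation: $\Delta(r,s)=\mu(D(f-r)\wedge D(s-f))$ (lower real) and $\Delta[r',s']=1-\mu(D(r'-f))-\mu(D(f-s'))$ (upper real). -}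

module Defs where

open import Data.Nat using (ℕ)
open import Data.Integer using (+_)
open import Data.Rational using (ℚ; 0ℚ; 1ℚ; _<_; _≤_; _/_)
  renaming (_+_ to _+ℚ_; _*_ to _*ℚ_; _-_ to _-ℚ_)
open import Data.Product using (Σ; ∃; ∃-syntax; _×_; _,_)
open import Data.Sum using (_⊎_)
open import Relation.Binary using (IsPartialOrder)
open import Function using (_⇔_)

ℕ→ℚ : ℕ → ℚ
ℕ→ℚ n = (+ n) / 1

record RieszSpace : Set₁ where
  infixl 6 _+_ _-_
  infixr 7 _·_
  infix 4 _≈_ _⊑_
  field
    Carrier : Set
    _≈_     : Carrier → Carrier → Set
    _⊑_     : Carrier → Carrier → Set
    _+_     : Carrier → Carrier → Carrier
    0#      : Carrier
    -_      : Carrier → Carrier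
    _·_     : ℚ → Carrier → Carrier
    _∨_     : Carrier → Carrier → Carrier
    _∧_     : Carrier → Carrier → Carrier
    isPartialOrder : IsPartialOrder _≈_ _⊑_
    +-cong : ∀ {x y u v} → x ≈ y → u ≈ v → x + u ≈ y + v
    -‿cong : ∀ {x y} → x ≈ y → - x ≈ - y
    ·-cong : ∀ p {x y} → x ≈ y → p · x ≈ p · y
    ∨-cong : ∀ {x y u v} → x ≈ y → u ≈ v → (x ∨ u) ≈ (y ∨ v)
    ∧-cong : ∀ {x y u v} → x ≈ y → u ≈ v → (x ∧ u) ≈ (y ∧ v)
    +-assoc     : ∀ x y z → (x + y) + z ≈ x + (y + z)
    +-comm      : ∀ x y → x + y ≈ y + x
    +-identityˡ : ∀ x → 0# + x ≈ x
    -‿inverseˡ  : ∀ x → (- x) + x ≈ 0#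
    ·-assoc      : ∀ p q x → p · (q · x) ≈ (p *ℚ q) · x
    ·-identity   : ∀ x → 1ℚ · x ≈ x
    ·-distribˡ   : ∀ p x y → p · (x + y) ≈ p · x + p · y
    ·-distribʳ   : ∀ p q x → (p +ℚ q) · x ≈ p · x + q · x
    x⊑x∨y : ∀ x y → x ⊑ x ∨ y
    y⊑x∨y : ∀ x y → y ⊑ x ∨ y
    ∨-least : ∀ {x y z} → x ⊑ z → y ⊑ z → x ∨ y ⊑ z
    x∧y⊑x : ∀ x y → x ∧ y ⊑ x
    x∧y⊑y : ∀ x y → x ∧ y ⊑ y
    ∧-greatest : ∀ {x y z} → z ⊑ x → z ⊑ y → z ⊑ x ∧ y
    +-mono : ∀ {x y} z → x ⊑ y → x + z ⊑ y + z
    ·-mono : ∀ {x y} p → 0ℚ ≤ p → x ⊑ y → p · x ⊑ p · y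

  _-_ : Carrier → Carrier → Carrier
  x - y = x + (- y)

-- A Riesz space with a strong unit 1; rationals q are identified with q · 1.
record RieszSpaceWithUnit : Set₁ where
  field
    riesz : RieszSpace
  open RieszSpace riesz public
  field
    unit : Carrier
    strongUnit : ∀ x → ∃[ n ] ((- (ℕ→ℚ n · unit) ⊑ x) × (x ⊑ ℕ→ℚ n · unit))

  ⟪_⟫ : ℚ → Carrier
  ⟪ q ⟫ = q · unit

-- Spec(R): the distributive lattice generated by symbols D(a),
-- presented by lattice terms modulo the congruence generated by the
-- distributive lattice axioms and the defining relations.

module Spec (R : RieszSpaceWithUnit) where
  open RieszSpaceWithUnit R

  infixr 6 _⋁_
  infixr 7 _⋀_
  infix 4 _~_ _≼_

  data Term : Set where
    D   : Carrier → Term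
    ⊤ ⊥ : Term
    _⋁_ _⋀_ : Term → Term → Term

  data _~_ : Term → Term → Set

  _≼_ : Term → Term → Set
  x ≼ y = x ⋀ y ~ x

  data _~_ where
    ~-refl  : ∀ {x} → x ~ x
    ~-sym   : ∀ {x y} → x ~ y → y ~ x
    ~-trans : ∀ {x y z} → x ~ y → y ~ z → x ~ z
    ⋁-cong  : ∀ {x y u v} → x ~ y → u ~ v → x ⋁ u ~ y ⋁ v
    ⋀-cong  : ∀ {x y u v} → x ~ y → u ~ v → x ⋀ u ~ y ⋀ v
    ⋁-assoc : ∀ x y z → (x ⋁ y) ⋁ z ~ x ⋁ (y ⋁ z)
    ⋀-assoc : ∀ x y z → (x ⋀ y) ⋀ z ~ x ⋀ (y ⋀ z)
    ⋁-comm  : ∀ x y → x ⋁ y ~ y ⋁ x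
    ⋀-comm  : ∀ x y → x ⋀ y ~ y ⋀ x
    ⋁-absorbs-⋀ : ∀ x y → x ⋁ (x ⋀ y) ~ x
    ⋀-absorbs-⋁ : ∀ x y → x ⋀ (x ⋁ y) ~ x
    ⋀-distrib-⋁ : ∀ x y z → x ⋀ (y ⋁ z) ~ (x ⋀ y) ⋁ (x ⋀ z)
    ⋁-identity : ∀ x → x ⋁ ⊥ ~ x
    ⋀-identity : ∀ x → x ⋀ ⊤ ~ x
    D-cong : ∀ {a b} → a ≈ b → D a ~ D b
    D-unit : D unit ~ ⊤
    D-neg  : ∀ a → D a ⋀ D (- a) ~ ⊥
    D-add  : ∀ a b → D (a + b) ≼ D a ⋁ D b
    D-nonpos : ∀ {a} → a ⊑ 0# → D a ~ ⊥
    D-join : ∀ a b → D (a ∨ b) ~ D a ⋁ D b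

-- "p < x" is  LowerReal.lower x p
record LowerReal : Set₁ where
  field
    lower    : ℚ → Set
    inhabited : ∃[ p ] lower p
    downward : ∀ {p q} → p < q → lower q → lower p
    rounded  : ∀ {p} → lower p → ∃[ q ] (p < q × lower q)
open LowerReal public

_≤L_ : LowerReal → LowerReal → Set
x ≤L y = ∀ p → lower x p → lower y p

_≡L_ : LowerReal → LowerReal → Set
x ≡L y = ∀ p → lower x p ⇔ lower y p

IsRat : LowerReal → ℚ → Set
IsRat x q = ∀ p → lower x p ⇔ (p < q)

NonNeg : LowerReal → Set
NonNeg x = ∀ p → p < 0ℚ → lower x p

SumL : LowerReal → LowerReal → ℚ → Set
SumL x y p = ∃[ a ] ∃[ b ] (lower x a × lower y b × p < a +ℚ b)

SumEq : LowerReal → LowerReal → LowerReal → LowerReal → Set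
SumEq x y u v = ∀ p → SumL x y p ⇔ SumL u v p

module _ (R : RieszSpaceWithUnit) where
  open RieszSpaceWithUnit R
  open Spec R

  record Valuation : Set₁ where
    field
      μ : Term → LowerReal
      μ-cong    : ∀ {x y} → x ~ y → μ x ≡L μ y
      μ-nonneg  : ∀ x → NonNeg (μ x)
      μ-⊥       : IsRat (μ ⊥) 0ℚ
      μ-⊤       : IsRat (μ ⊤) 1ℚ
      μ-modular : ∀ x y → SumEq (μ x) (μ y) (μ (x ⋁ y)) (μ (x ⋀ y))
      μ-mono    : ∀ {x y} → x ≼ y → μ x ≤L μ y
      μ-cont    : ∀ a p → lower (μ (D a)) p →
                  ∃[ ε ] (0ℚ < ε × lower (μ (D (a - ⟪ ε ⟫))) p)

  module _ (V : Valuation) where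
    open Valuation V

    _<Δ⟨_,_⟩_ : ℚ → ℚ → ℚ → Carrier → Set
    p <Δ⟨ r , s ⟩ f = lower (μ (D (f - ⟪ r ⟫) ⋀ D (⟪ s ⟫ - f))) p

    -- Δ[r',s'] < q  where Δ[r',s'] = 1 - μ(D(r'-f)) - μ(D(f-s')) (upper real):
    -- 1 - A - B < q  iff  1 - q < A + B
    Δ[_,_]⟨_⟩<_ : ℚ → ℚ → Carrier → ℚ → Set
    Δ[ r' , s' ]⟨ f ⟩< q = SumL (μ (D (⟪ r' ⟫ - f))) (μ (D (f - ⟪ s' ⟫))) (1ℚ -ℚ q)

-- With X = D(f - r), Y = D(s - f), B = D(r' - f) and C = D(f - s'), the
-- hypotheses r < r' and s' < s give X ∨ B = 1 and C ∨ Y = 1 in Spec(R) (the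
-- differences sum to a positive multiple of the strong unit), hence
-- μX + μB ≥ 1 and μC + μY ≥ 1. Modularity and μ(X ∨ Y) ≤ 1 give
-- μX + μY ≤ 1 + μ(X ∧ Y); adding up, Δ[I] = 1 - μB - μC ≤ μ(X ∧ Y) = Δ(J).
-- Constructively one splits the gap q - p at a rational m, approximates each
-- lower real from below within its share of the gap, and decides p < a for the
-- resulting rational approximation a of Δ(J).
module Submission where

open import Defs
open import Data.Nat using (ℕ; zero; suc)
open import Data.Integer using (+_)
open import Data.Rational using (ℚ; toℚᵘ; 0ℚ; 1ℚ; _<_; _≤_; 1/_; NonZero; >-nonZero)
  renaming (_+_ to _+ℚ_; _*_ to _*ℚ_; _-_ to _-ℚ_; -_ to -ℚ_)
import Data.Rational.Properties as ℚ
import Data.Rational.Unnormalised as ℚᵘ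
import Data.Rational.Unnormalised.Properties as ℚᵘ
open import Data.Product using (∃-syntax; _×_; _,_; proj₁; proj₂)
open import Data.Sum using (_⊎_; inj₁; inj₂)
open import Function using (_∘_)
open import Function.Bundles using (module Equivalence)
open import Relation.Nullary using (yes; no)
open import Relation.Binary.PropositionalEquality using (_≡_; refl; sym; trans; cong)
import Data.Integer as ℤ
import Data.Integer.Properties as ℤ
open import Relation.Binary.Bundles using (Setoid)
open import Relation.Binary.Structures using (IsPartialOrder)
open import Algebra.Bundles using (AbelianGroup)
import Algebra.Consequences.Setoid as Consequences
import Algebra.Properties.Group as GroupProperties
open import Algebra.Lattice.Bundles using (Lattice)
import Algebra.Lattice.Properties.Lattice as LatticeProperties
import Relation.Binary.Lattice.Bundles as Order

-- ℕ→ℚ n normalises the unnormalised n/1, so the identity is checked in ℚᵘ.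
ℕ→ℚ-suc : ∀ n → ℕ→ℚ (suc n) ≡ 1ℚ +ℚ ℕ→ℚ n
ℕ→ℚ-suc n = ℚ.toℚᵘ-injective (begin
  toℚᵘ (ℕ→ℚ (suc n))                      ≈⟨ ℚ.toℚᵘ-fromℚᵘ [1+n] ⟩
  [1+n]                                   ≈⟨ ℚᵘ.*≡* cross-multiplied ⟩
  [1] ℚᵘ.+ [n]                            ≈⟨ ℚᵘ.+-cong (ℚ.toℚᵘ-fromℚᵘ [1]) (ℚ.toℚᵘ-fromℚᵘ [n]) ⟨
  toℚᵘ 1ℚ ℚᵘ.+ toℚᵘ (ℕ→ℚ n)                ≈⟨ ℚ.toℚᵘ-homo-+ 1ℚ (ℕ→ℚ n) ⟨
  toℚᵘ (1ℚ +ℚ ℕ→ℚ n)                      ∎)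
  where
  open ℚᵘ.≃-Reasoning
  [1+n] [1] [n] : ℚᵘ.ℚᵘ
  [1+n] = ℚᵘ.mkℚᵘ (+ suc n) 0
  [1]   = ℚᵘ.mkℚᵘ (+ 1) 0
  [n]   = ℚᵘ.mkℚᵘ (+ n) 0
  cross-multiplied : + suc n ℤ.* + 1 ≡ (+ 1 ℤ.* + 1 ℤ.+ + n ℤ.* + 1) ℤ.* + 1
  cross-multiplied = trans (ℤ.*-identityʳ (+ suc n))
    (sym (trans (ℤ.*-identityʳ _) (cong (ℤ._+_ (+ 1)) (ℤ.*-identityʳ (+ n)))))

module RationalLemmas where
  open import Data.Rational using (_+_; _-_; -_)
  open import Data.Rational.Solver using (module +-*-Solver)
  open +-*-Solver
  open ℚ.≤-Reasoning

  p<q⇒0<q-p : ∀ {p q} → p < q → 0ℚ < q - p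
  p<q⇒0<q-p {p} {q} p<q = begin-strict
    0ℚ     ≡⟨ ℚ.+-inverseʳ p ⟨
    p - p  <⟨ ℚ.+-monoˡ-< (- p) p<q ⟩
    q - p  ∎

  p<q⇒p-q<0 : ∀ {p q} → p < q → p - q < 0ℚ
  p<q⇒p-q<0 {p} {q} p<q = begin-strict
    p - q  <⟨ ℚ.+-monoˡ-< (- q) p<q ⟩
    q - q  ≡⟨ ℚ.+-inverseʳ q ⟩
    0ℚ     ∎

  p-q<r⇒p<q+r : ∀ {p q r} → p - q < r → p < q + r
  p-q<r⇒p<q+r {p} {q} {r} p-q<r = begin-strict
    p            ≡⟨ solve 2 (λ p q → p := q :+ (p :- q)) refl p q ⟩
    q + (p - q)  <⟨ ℚ.+-monoʳ-< q p-q<r ⟩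
    q + r        ∎

  0<q⇒p-q<p : ∀ {p q} → 0ℚ < q → p - q < p
  0<q⇒p-q<p {p} {q} 0<q = begin-strict
    p - q   <⟨ ℚ.+-monoʳ-< p (ℚ.neg-antimono-< 0<q) ⟩
    p - 0ℚ  ≡⟨ ℚ.+-identityʳ p ⟩
    p       ∎

  1-q<b+c : ∀ p q m x y a b c → 1ℚ - (q - m) < x + b → 1ℚ - (m - p) < c + y →
            x + y < 1ℚ + a → a ≤ p → 1ℚ - q < b + c
  1-q<b+c p q m x y a b c h₁ h₂ x+y<1+a a≤p = begin-strict
    1ℚ - q
      ≡⟨ solve 3 (λ p q m → con 1ℚ :- q
                          := ((con 1ℚ :- (q :- m)) :+ (con 1ℚ :- (m :- p))) :- (con 1ℚ :+ p))
                 refl p q m ⟩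
    ((1ℚ - (q - m)) + (1ℚ - (m - p))) - (1ℚ + p)
      <⟨ ℚ.+-monoˡ-< (- (1ℚ + p)) (ℚ.+-mono-< h₁ h₂) ⟩
    ((x + b) + (c + y)) - (1ℚ + p)
      ≡⟨ cong (_- (1ℚ + p)) (solve 4 (λ x y b c → (x :+ b) :+ (c :+ y) := (x :+ y) :+ (b :+ c))
                                     refl x y b c) ⟩
    ((x + y) + (b + c)) - (1ℚ + p)
      <⟨ ℚ.+-monoˡ-< (- (1ℚ + p)) (ℚ.+-monoˡ-< (b + c) x+y<1+a) ⟩
    ((1ℚ + a) + (b + c)) - (1ℚ + p)
      ≤⟨ ℚ.+-monoˡ-≤ (- (1ℚ + p)) (ℚ.+-monoˡ-≤ (b + c) (ℚ.+-monoʳ-≤ 1ℚ a≤p)) ⟩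
    ((1ℚ + p) + (b + c)) - (1ℚ + p)
      ≡⟨ solve 2 (λ d e → (d :+ e) :- d := e) refl (1ℚ + p) (b + c) ⟩
    b + c
      ∎

SumL-+ : ∀ (x y : LowerReal) {a b} → lower x a → lower y b → SumL x y (a +ℚ b)
SumL-+ x y {a} {b} a<x b<y =
  let a′ , a<a′ , a′<x = rounded x a<x
  in a′ , b , a′<x , b<y , ℚ.+-monoˡ-< b a<a′

module RieszSpaceProperties (R : RieszSpace) where
  open RieszSpace R

  setoid : Setoid _ _
  setoid = record { isEquivalence = IsPartialOrder.isEquivalence isPartialOrder }

  open Setoid setoid public using () renaming (refl to ≈-refl; sym to ≈-sym)
  open Consequences setoid using (comm∧idˡ⇒id; comm∧invˡ⇒inv)

  +-abelianGroup : AbelianGroup _ _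
  +-abelianGroup = record
    { isAbelianGroup = record
      { isGroup = record
        { isMonoid = record
          { isSemigroup = record
            { isMagma = record { isEquivalence = Setoid.isEquivalence setoid ; ∙-cong = +-cong }
            ; assoc = +-assoc }
          ; identity = comm∧idˡ⇒id +-comm +-identityˡ }
        ; inverse = comm∧invˡ⇒inv +-comm -‿inverseˡ
        ; ⁻¹-cong = -‿cong }
      ; comm = +-comm } }

  open AbelianGroup +-abelianGroup public using (identityʳ; inverseʳ; group)
  open GroupProperties group public using (∙-cancelˡ; inverseʳ-unique; //-rightDividesˡ; \\-leftDividesʳ)
  open import Relation.Binary.Reasoning.Setoid setoid

  -‿+-telescope : ∀ x y z → (x - y) + (y - z) ≈ x - z
  -‿+-telescope x y z = begin
    (x - y) + (y - z)    ≈⟨ +-assoc x (- y) (y - z) ⟩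
    x + (- y + (y - z))  ≈⟨ +-cong ≈-refl (\\-leftDividesʳ y (- z)) ⟩
    x - z                ∎

  ·-zeroˡ : ∀ x → 0ℚ · x ≈ 0#
  ·-zeroˡ x = ∙-cancelˡ (0ℚ · x) (0ℚ · x) 0# (begin
    0ℚ · x + 0ℚ · x  ≈⟨ ·-distribʳ 0ℚ 0ℚ x ⟨
    (0ℚ +ℚ 0ℚ) · x   ≡⟨⟩
    0ℚ · x           ≈⟨ identityʳ (0ℚ · x) ⟨
    0ℚ · x + 0#      ∎)

  ·-negˡ : ∀ p x → (-ℚ p) · x ≈ - (p · x)
  ·-negˡ p x = inverseʳ-unique (p · x) ((-ℚ p) · x) (begin
    p · x + (-ℚ p) · x  ≈⟨ ·-distribʳ p (-ℚ p) x ⟨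
    (p -ℚ p) · x        ≡⟨ cong (_· x) (ℚ.+-inverseʳ p) ⟩
    0ℚ · x              ≈⟨ ·-zeroˡ x ⟩
    0#                  ∎)

  ·-distribʳ-sub : ∀ p q x → (p -ℚ q) · x ≈ p · x - q · x
  ·-distribʳ-sub p q x = begin
    (p -ℚ q) · x        ≈⟨ ·-distribʳ p (-ℚ q) x ⟩
    p · x + (-ℚ q) · x  ≈⟨ +-cong ≈-refl (·-negˡ q x) ⟩
    p · x - q · x       ∎

  ·-suc : ∀ n x → ℕ→ℚ (suc n) · x ≈ x + ℕ→ℚ n · x
  ·-suc n x = begin
    ℕ→ℚ (suc n) · x     ≡⟨ cong (_· x) (ℕ→ℚ-suc n) ⟩
    (1ℚ +ℚ ℕ→ℚ n) · x   ≈⟨ ·-distribʳ 1ℚ (ℕ→ℚ n) x ⟩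
    1ℚ · x + ℕ→ℚ n · x  ≈⟨ +-cong (·-identity x) ≈-refl ⟩
    x + ℕ→ℚ n · x       ∎

  ·-comm : ∀ p q x → p · (q · x) ≈ q · (p · x)
  ·-comm p q x = begin
    p · (q · x)   ≈⟨ ·-assoc p q x ⟩
    (p *ℚ q) · x  ≡⟨ cong (_· x) (ℚ.*-comm p q) ⟩
    (q *ℚ p) · x  ≈⟨ ·-assoc q p x ⟨
    q · (p · x)   ∎

  ·-inverseʳ : ∀ c .{{_ : NonZero c}} x → c · ((1/ c) · x) ≈ x
  ·-inverseʳ c x = begin
    c · ((1/ c) · x)    ≈⟨ ·-assoc c (1/ c) x ⟩
    (c *ℚ 1/ c) · x     ≡⟨ cong (_· x) (ℚ.*-inverseʳ c) ⟩
    1ℚ · x              ≈⟨ ·-identity x ⟩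
    x                   ∎

  open IsPartialOrder isPartialOrder public using () renaming (trans to ⊑-trans; reflexive to ⊑-reflexive)

  x⊑y⇒x-y⊑0 : ∀ {x y} → x ⊑ y → x - y ⊑ 0#
  x⊑y⇒x-y⊑0 {x} {y} x⊑y = ⊑-trans (+-mono (- y) x⊑y) (⊑-reflexive (inverseʳ y))

module SpecProperties (R : RieszSpaceWithUnit) where
  open RieszSpaceWithUnit R
  open RieszSpaceProperties riesz
  open RationalLemmas using (p<q⇒0<q-p)
  open Spec R

  lattice : Lattice _ _
  lattice = record
    { Carrier = Term
    ; _≈_ = _~_
    ; _∨_ = _⋁_
    ; _∧_ = _⋀_
    ; isLattice = record
      { isEquivalence = record { refl = ~-refl ; sym = ~-sym ; trans = ~-trans }
      ; ∨-comm = ⋁-comm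
      ; ∨-assoc = ⋁-assoc
      ; ∨-cong = ⋁-cong
      ; ∧-comm = ⋀-comm
      ; ∧-assoc = ⋀-assoc
      ; ∧-cong = ⋀-cong
      ; absorptive = ⋁-absorbs-⋀ , ⋀-absorbs-⋁ } }

  open Order.Lattice (LatticeProperties.∨-∧-orderTheoreticLattice lattice) public
    using (poset; x∧y≤y) renaming (_≤_ to _≤ₛ_; refl to ≤ₛ-refl; ∨-least to ⋁-least)
  open import Relation.Binary.Reasoning.PartialOrder poset

  ≼⇒≤ₛ : ∀ {x y} → x ≼ y → x ≤ₛ y
  ≼⇒≤ₛ = ~-sym

  ≤ₛ⇒≼ : ∀ {x y} → x ≤ₛ y → x ≼ y
  ≤ₛ⇒≼ = ~-sym

  ⊥-minimum : ∀ x → ⊥ ≤ₛ x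
  ⊥-minimum x = begin
    ⊥            ≈⟨ ⋀-absorbs-⋁ ⊥ x ⟨
    ⊥ ⋀ (⊥ ⋁ x)  ≤⟨ x∧y≤y ⊥ (⊥ ⋁ x) ⟩
    ⊥ ⋁ x        ≈⟨ ⋁-comm ⊥ x ⟩
    x ⋁ ⊥        ≈⟨ ⋁-identity x ⟩
    x            ∎

  ⊤-maximum : ∀ x → x ≤ₛ ⊤
  ⊤-maximum x = ~-sym (⋀-identity x)

  D-mono : ∀ {a b} → a ⊑ b → D a ≤ₛ D b
  D-mono {a} {b} a⊑b = begin
    D a                  ≈⟨ D-cong (//-rightDividesˡ b a) ⟨
    D ((a - b) + b)      ≤⟨ ≼⇒≤ₛ (D-add (a - b) b) ⟩
    D (a - b) ⋁ D b      ≈⟨ ⋁-cong (D-nonpos (x⊑y⇒x-y⊑0 a⊑b)) ~-refl ⟩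
    ⊥ ⋁ D b              ≈⟨ ⋁-comm ⊥ (D b) ⟩
    D b ⋁ ⊥              ≈⟨ ⋁-identity (D b) ⟩
    D b                  ∎

  D-ℕ· : ∀ n a → D (ℕ→ℚ n · a) ≤ₛ D a
  D-ℕ· zero a = begin
    D (0ℚ · a)  ≈⟨ D-nonpos (⊑-reflexive (·-zeroˡ a)) ⟩
    ⊥           ≤⟨ ⊥-minimum (D a) ⟩
    D a         ∎
  D-ℕ· (suc n) a = begin
    D (ℕ→ℚ (suc n) · a)    ≈⟨ D-cong (·-suc n a) ⟩
    D (a + ℕ→ℚ n · a)      ≤⟨ ≼⇒≤ₛ (D-add a (ℕ→ℚ n · a)) ⟩
    D a ⋁ D (ℕ→ℚ n · a)    ≤⟨ ⋁-least ≤ₛ-refl (D-ℕ· n a) ⟩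
    D a                    ∎

  ⊤≤D⟪pos⟫ : ∀ {c} → 0ℚ < c → ⊤ ≤ₛ D ⟪ c ⟫
  ⊤≤D⟪pos⟫ {c} 0<c = begin
    ⊤                      ≈⟨ D-unit ⟨
    D unit                 ≤⟨ D-mono unit⊑n·⟪c⟫ ⟩
    D (ℕ→ℚ n · ⟪ c ⟫)      ≤⟨ D-ℕ· n ⟪ c ⟫ ⟩
    D ⟪ c ⟫                ∎
    where
    instance
      c≢0 : NonZero c
      c≢0 = >-nonZero 0<c
    n : ℕ
    n = proj₁ (strongUnit ⟪ 1/ c ⟫)
    unit⊑n·⟪c⟫ : unit ⊑ ℕ→ℚ n · ⟪ c ⟫
    unit⊑n·⟪c⟫ = ⊑-trans (⊑-reflexive (≈-sym (·-inverseʳ c unit)))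
                 (⊑-trans (·-mono c (ℚ.<⇒≤ 0<c) (proj₂ (proj₂ (strongUnit ⟪ 1/ c ⟫))))
                          (⊑-reflexive (·-comm c (ℕ→ℚ n) unit)))

  D-cover : ∀ x {y z} → y < z → ⊤ ≤ₛ D (x - ⟪ y ⟫) ⋁ D (⟪ z ⟫ - x)
  D-cover x {y} {z} y<z = begin
    ⊤                                ≤⟨ ⊤≤D⟪pos⟫ (p<q⇒0<q-p y<z) ⟩
    D ⟪ z -ℚ y ⟫                     ≈⟨ D-cong (·-distribʳ-sub z y unit) ⟩
    D (⟪ z ⟫ - ⟪ y ⟫)                ≈⟨ D-cong (-‿+-telescope ⟪ z ⟫ x ⟪ y ⟫) ⟨
    D ((⟪ z ⟫ - x) + (x - ⟪ y ⟫))    ≤⟨ ≼⇒≤ₛ (D-add (⟪ z ⟫ - x) (x - ⟪ y ⟫)) ⟩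
    D (⟪ z ⟫ - x) ⋁ D (x - ⟪ y ⟫)    ≈⟨ ⋁-comm (D (⟪ z ⟫ - x)) (D (x - ⟪ y ⟫)) ⟩
    D (x - ⟪ y ⟫) ⋁ D (⟪ z ⟫ - x)    ∎

module ValuationProperties (R : RieszSpaceWithUnit) (V : Valuation R) where
  open Spec R
  open SpecProperties R using (_≤ₛ_; ≤ₛ⇒≼; ⊤-maximum)
  open Valuation V
  open RationalLemmas
  open Equivalence using (to; from)
  open import Data.Rational using (_+_; _-_; _<?_)

  μ-≤ₛ : ∀ {x y} → x ≤ₛ y → μ x ≤L μ y
  μ-≤ₛ = μ-mono ∘ ≤ₛ⇒≼

  μ-cover : ∀ {X Y t} → ⊤ ≤ₛ X ⋁ Y → t < 1ℚ → SumL (μ X) (μ Y) t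
  μ-cover {X} {Y} {t} ⊤≤X⋁Y t<1 =
    let m , t<m , m<1 = ℚ.<-dense t<1
        b , t-m<b , b<0 = ℚ.<-dense (p<q⇒p-q<0 t<m)
        m<μ[X⋁Y] = μ-≤ₛ ⊤≤X⋁Y m (from (μ-⊤ m) m<1)
        b<μ[X⋀Y] = μ-nonneg (X ⋀ Y) b b<0
    in from (μ-modular X Y t) (m , b , m<μ[X⋁Y] , b<μ[X⋀Y] , p-q<r⇒p<q+r t-m<b)

  μ-⋀-bound : ∀ {X Y t} → SumL (μ X) (μ Y) t → ∃[ a ] (lower (μ (X ⋀ Y)) a × t < 1ℚ + a)
  μ-⋀-bound {X} {Y} {t} t<μX+μY =
    let a₁ , a , a₁<μ[X⋁Y] , a<μ[X⋀Y] , t<a₁+a = to (μ-modular X Y t) t<μX+μY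
        a₁<1 = to (μ-⊤ a₁) (μ-≤ₛ (⊤-maximum (X ⋁ Y)) a₁ a₁<μ[X⋁Y])
    in a , a<μ[X⋀Y] , ℚ.<-trans t<a₁+a (ℚ.+-monoˡ-< a a₁<1)

  μ-⋀-or-complement : ∀ {X Y B C p q} → ⊤ ≤ₛ X ⋁ B → ⊤ ≤ₛ C ⋁ Y → p < q →
                      lower (μ (X ⋀ Y)) p ⊎ SumL (μ B) (μ C) (1ℚ - q)
  -- The witnesses are taken apart by typed helpers rather than let or with, which
  -- would expose them as (expensive to normalise) projections of ℚ.<-dense.
  μ-⋀-or-complement {X} {Y} {B} {C} {p} {q} ⊤≤X⋁B ⊤≤C⋁Y p<q = split (ℚ.<-dense p<q)
    where
    Goal : Set
    Goal = lower (μ (X ⋀ Y)) p ⊎ SumL (μ B) (μ C) (1ℚ - q)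

    split : ∃[ m ] (p < m × m < q) → Goal
    split (m , p<m , m<q) = covers (μ-cover ⊤≤X⋁B (0<q⇒p-q<p (p<q⇒0<q-p m<q)))
                                   (μ-cover ⊤≤C⋁Y (0<q⇒p-q<p (p<q⇒0<q-p p<m)))
      where
      covers : SumL (μ X) (μ B) (1ℚ - (q - m)) → SumL (μ C) (μ Y) (1ℚ - (m - p)) → Goal
      covers (x , b , x<μX , b<μB , 1-[q-m]<x+b) (c , y , c<μC , y<μY , 1-[m-p]<c+y) =
        meet (μ-⋀-bound (SumL-+ (μ X) (μ Y) x<μX y<μY))
        where
        meet : ∃[ a ] (lower (μ (X ⋀ Y)) a × x + y < 1ℚ + a) → Goal
        meet (a , a<μ[X⋀Y] , x+y<1+a) with p <? a
        ... | yes p<a = inj₁ (downward (μ (X ⋀ Y)) p<a a<μ[X⋀Y])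
        ... | no p≮a = inj₂ (b , c , b<μB , c<μC ,
                               1-q<b+c p q m x y a b c 1-[q-m]<x+b 1-[m-p]<c+y x+y<1+a (ℚ.≮⇒≥ p≮a))

lemma4p13 : (R : RieszSpaceWithUnit) (V : Valuation R)
            (f : RieszSpaceWithUnit.Carrier R) →
            RieszSpace._⊑_ (RieszSpaceWithUnit.riesz R) (RieszSpaceWithUnit.0# R) f →
            (r r' s' s : ℚ) → r < r' → r' < s' → s' < s →
            (p q : ℚ) → p < q →
            (_<Δ⟨_,_⟩_ R V p r s f) ⊎ (Δ[_,_]⟨_⟩<_ R V r' s' f q)
lemma4p13 R V f _ r r' s' s r<r' _ s'<s p q p<q =
  μ-⋀-or-complement (D-cover f r<r') (D-cover f s'<s) p<q
  where
  open SpecProperties R using (D-cover)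
  open ValuationProperties R V using (μ-⋀-or-complement)
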